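{- Let $a,b,k$ be positive integers with $a\le b$. If $a+b\le k$, then $\gamma_{{\rm r}k}(K_{a,b})=a+b$. If $a+b>k$, then $\gamma_{{\rm r}k}(K_{a,b})=2k$ when $a\ge 2k$, and $\gamma_{{\rm r}k}(K_{a,b})=\max\{a,k\}$ when $a<2k$.
   Context: All graphs are finite, simple and undirected; $N(v)$ denotes the open neighborhood of $v$, and $[k]=\{1,\dots,k\}$. A $k$-rainbow dominating function ($k$RDF) of a graph $G$ is a function $f:V(G)\to 2^{[k]}$ such that every vertex $v$ with $f(v)=\emptyset$ satisfies $\bigcup_{u\in N(v)}f(u)=[k]$. Its weight is $\|f\|=\sum_{v\in V(G)}|f(v)|$, and the $k$-rainbow domination number $\gamma_{{\rm r}k}(G)$ is the minimum weight of a $k$RDF of $G$. $K_{a,b}$ denotes the complete bipartite graph with parts of sizes $a$ and $b$. -}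

module Defs where

open import Data.Nat using (ℕ; _+_; _<_; _≤_)
open import Data.Fin using (Fin; toℕ)
open import Data.Fin.Subset using (Subset; ⊥; _∈_; ∣_∣)
open import Data.Vec using (tabulate; sum)
open import Data.Product using (Σ; ∃; _×_)
open import Data.Sum using (_⊎_)
open import Relation.Binary.PropositionalEquality using (_≡_)
open import Relation.Nullary using (¬_)

record Graph : Set₁ where
  field
    order : ℕ
    Adj   : Fin order → Fin order → Set
    sym   : ∀ {u v} → Adj u v → Adj v u
    irrefl : ∀ {v} → ¬ Adj v v
open Graph public

-- Complete bipartite graph K_{a,b}: vertices 0..a-1 form one part,
-- vertices a..a+b-1 the other part.
KAdj : (a b : ℕ) → Fin (a + b) → Fin (a + b) → Set
KAdj a b u v = (toℕ u < a × a ≤ toℕ v) ⊎ (a ≤ toℕ u × toℕ v < a)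

private
  open import Data.Nat.Properties using (<⇒≱)
  open import Data.Sum using (inj₁; inj₂)
  open import Data.Product using (_,_)

  KAdj-sym : (a b : ℕ) → ∀ {u v} → KAdj a b u v → KAdj a b v u
  KAdj-sym a b (inj₁ (p , q)) = inj₂ (q , p)
  KAdj-sym a b (inj₂ (p , q)) = inj₁ (q , p)

  KAdj-irrefl : (a b : ℕ) → ∀ {v} → ¬ KAdj a b v v
  KAdj-irrefl a b (inj₁ (p , q)) = <⇒≱ p q
  KAdj-irrefl a b (inj₂ (p , q)) = <⇒≱ q p

K : ℕ → ℕ → Graph
K a b = record
  { order = a + b ; Adj = KAdj a b
  ; sym = KAdj-sym a b ; irrefl = KAdj-irrefl a b }

IsKRDF : (G : Graph) (k : ℕ) → (Fin (order G) → Subset k) → Set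
IsKRDF G k f = ∀ v → f v ≡ ⊥ → ∀ (c : Fin k) → ∃ λ u → Adj G v u × c ∈ f u

weight : (G : Graph) (k : ℕ) → (Fin (order G) → Subset k) → ℕ
weight G k f = sum (tabulate (λ v → ∣ f v ∣))

RainbowDominationNumber : (G : Graph) (k m : ℕ) → Set
RainbowDominationNumber G k m =
  (Σ (Fin (order G) → Subset k) λ f → IsKRDF G k f × weight G k f ≡ m)
  × (∀ f → IsKRDF G k f → m ≤ weight G k f)

module Submission where

-- Write A (size a) and B (size b) for the two parts and x, y for
-- the weight a kRDF puts on A and on B.  If some vertex of A gets ∅,
-- its neighbourhood B must carry all k colours, so k ≤ y; otherwise
-- every vertex of A is nonempty and a ≤ x.  Symmetrically b ≤ y or
-- k ≤ x.  The four combinations give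
--     weight ≥ μ(a,b,k) = (a + b) ⊓ (a ⊔ k) ⊓ 2k          (using a ≤ b).
-- Conversely three explicit kRDFs exist: every vertex gets one colour
-- (weight a + b); both parts spread the k colours one per vertex
-- (weight 2k, when k ≤ a); A gets nonempty sets covering [k] and B
-- gets nothing (weight a ⊔ k).  In each regime of the theorem the
-- relevant construction has weight T ≤ μ(a,b,k), so T is the minimum.

open import Defs
open import Data.Nat using (ℕ; zero; suc; _+_; _*_; _≤_; _<_; _⊔_; _⊓_; z≤n; s≤s)
open import Data.Nat.Properties
open import Data.Product using (_×_; _,_; ∃; Σ)
open import Data.Sum using (_⊎_; inj₁; inj₂; [_,_]′)
open import Data.Empty using (⊥-elim)
open import Data.Fin using (Fin; zero; suc; toℕ; _↑ˡ_; _↑ʳ_; splitAt)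
open import Data.Fin.Properties
  using (toℕ-↑ˡ; toℕ-↑ʳ; toℕ<n; splitAt-↑ˡ; splitAt-↑ʳ; splitAt⁻¹-↑ˡ; splitAt⁻¹-↑ʳ)
open import Data.Fin.Subset using (Subset; ⊥; ⊤; ⁅_⁆; _∪_; _∈_; ∣_∣; Nonempty; inside; outside)
open import Data.Fin.Subset.Properties
  using (∣⊥∣≡0; ∣⊤∣≡n; ∣⁅x⁆∣≡1; ∈⊤; ∉⊥; x∈⁅y⁆⇒x≡y; x∈p∪q⁺; p⊆q⇒∣p∣≤∣q∣; ∣p∣≤∣x∷p∣; nonempty?; Empty-unique)
open import Data.Vec using (_∷_; []; here; there; tabulate; sum)
open import Data.Vec.Properties using (tabulate-cong)
open import Relation.Nullary using (¬_; yes; no)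
open import Relation.Binary.PropositionalEquality
  using (_≡_; refl; trans; cong; cong₂; subst; module ≡-Reasoning)
  renaming (sym to ≡-sym)

total : ∀ {m k} → (Fin m → Subset k) → ℕ
total g = sum (tabulate (λ i → ∣ g i ∣))

Covers : ∀ {m k} → (Fin m → Subset k) → Set
Covers {k = k} g = (c : Fin k) → ∃ λ i → c ∈ g i

total-const : ∀ {k} m (p : Subset k) → total (λ (_ : Fin m) → p) ≡ m * ∣ p ∣
total-const zero    p = refl
total-const (suc m) p = cong (∣ p ∣ +_) (total-const m p)

sum-tabulate-↑ : ∀ a b (F : Fin (a + b) → ℕ) →
  sum (tabulate F) ≡ sum (tabulate (λ i → F (i ↑ˡ b))) + sum (tabulate (λ j → F (a ↑ʳ j)))
sum-tabulate-↑ zero    b F = refl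
sum-tabulate-↑ (suc a) b F =
  trans (cong (F zero +_) (sum-tabulate-↑ a b (λ v → F (suc v)))) (≡-sym (+-assoc (F zero) _ _))

∣p∪q∣≤∣p∣+∣q∣ : ∀ {k} (p q : Subset k) → ∣ p ∪ q ∣ ≤ ∣ p ∣ + ∣ q ∣
∣p∪q∣≤∣p∣+∣q∣ []            []            = z≤n
∣p∪q∣≤∣p∣+∣q∣ (inside  ∷ p) (s ∷ q)       =
  s≤s (≤-trans (∣p∪q∣≤∣p∣+∣q∣ p q) (+-monoʳ-≤ ∣ p ∣ (∣p∣≤∣x∷p∣ s q)))
∣p∪q∣≤∣p∣+∣q∣ (outside ∷ p) (inside  ∷ q) =
  subst (suc ∣ p ∪ q ∣ ≤_) (≡-sym (+-suc ∣ p ∣ ∣ q ∣)) (s≤s (∣p∪q∣≤∣p∣+∣q∣ p q))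
∣p∪q∣≤∣p∣+∣q∣ (outside ∷ p) (outside ∷ q) = ∣p∪q∣≤∣p∣+∣q∣ p q

⋃ᶠ : ∀ {m k} → (Fin m → Subset k) → Subset k
⋃ᶠ {zero}  g = ⊥
⋃ᶠ {suc m} g = g zero ∪ ⋃ᶠ (λ i → g (suc i))

∈⋃ᶠ : ∀ {m k} (g : Fin m → Subset k) {c : Fin k} (i : Fin m) → c ∈ g i → c ∈ ⋃ᶠ g
∈⋃ᶠ g zero    c∈ = x∈p∪q⁺ (inj₁ c∈)
∈⋃ᶠ g (suc i) c∈ = x∈p∪q⁺ (inj₂ (∈⋃ᶠ (λ i → g (suc i)) i c∈))

∣⋃ᶠ∣≤total : ∀ {m k} (g : Fin m → Subset k) → ∣ ⋃ᶠ g ∣ ≤ total g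
∣⋃ᶠ∣≤total {zero}  {k} g = ≤-reflexive (∣⊥∣≡0 k)
∣⋃ᶠ∣≤total {suc m}     g =
  ≤-trans (∣p∪q∣≤∣p∣+∣q∣ (g zero) _) (+-monoʳ-≤ ∣ g zero ∣ (∣⋃ᶠ∣≤total (λ i → g (suc i))))

covers⇒k≤total : ∀ {m k} (g : Fin m → Subset k) → Covers g → k ≤ total g
covers⇒k≤total {k = k} g cov = begin
  k           ≡⟨ ≡-sym (∣⊤∣≡n k) ⟩
  ∣ ⊤ {k} ∣   ≤⟨ p⊆q⇒∣p∣≤∣q∣ {p = ⊤} (λ {c} _ → let (i , c∈) = cov c in ∈⋃ᶠ g i c∈) ⟩
  ∣ ⋃ᶠ g ∣    ≤⟨ ∣⋃ᶠ∣≤total g ⟩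
  total g     ∎
  where open ≤-Reasoning

nonempty⇒1≤∣p∣ : ∀ {k} {p : Subset k} → Nonempty p → 1 ≤ ∣ p ∣
nonempty⇒1≤∣p∣ {p = p} (x , x∈p) =
  subst (_≤ ∣ p ∣) (∣⁅x⁆∣≡1 x) (p⊆q⇒∣p∣≤∣q∣ (λ y∈ → subst (_∈ p) (≡-sym (x∈⁅y⁆⇒x≡y x y∈)) x∈p))

nonempty⇒≢⊥ : ∀ {k} {p : Subset k} → Nonempty p → ¬ p ≡ ⊥
nonempty⇒≢⊥ (x , x∈p) refl = ∉⊥ x∈p

empty-or-m≤total : ∀ {m k} (g : Fin m → Subset k) → (∃ λ i → g i ≡ ⊥) ⊎ m ≤ total g
empty-or-m≤total {zero}  g = inj₂ z≤n
empty-or-m≤total {suc m} g with nonempty? (g zero) | empty-or-m≤total (λ i → g (suc i))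
... | no  ¬ne | _              = inj₁ (zero , Empty-unique ¬ne)
... | yes _   | inj₁ (i , g≡⊥) = inj₁ (suc i , g≡⊥)
... | yes ne  | inj₂ m≤        = inj₂ (+-mono-≤ (nonempty⇒1≤∣p∣ ne) m≤)

data Part (a b : ℕ) : Fin (a + b) → Set where
  inA : (i : Fin a) → Part a b (i ↑ˡ b)
  inB : (j : Fin b) → Part a b (a ↑ʳ j)

part : ∀ a b (v : Fin (a + b)) → Part a b v
part a b v with splitAt a v in eq
... | inj₁ i = subst (Part a b) (splitAt⁻¹-↑ˡ eq) (inA i)
... | inj₂ j = subst (Part a b) (splitAt⁻¹-↑ʳ eq) (inB j)

A-index : ∀ {a} b (i : Fin a) → toℕ (i ↑ˡ b) < a
A-index {a} b i = subst (_< a) (≡-sym (toℕ-↑ˡ i b)) (toℕ<n i)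

B-index : ∀ a {b} (j : Fin b) → a ≤ toℕ (a ↑ʳ j)
B-index a j = subst (a ≤_) (≡-sym (toℕ-↑ʳ a j)) (m≤m+n a (toℕ j))

AB-edge : ∀ {a b} (i : Fin a) (j : Fin b) → KAdj a b (i ↑ˡ b) (a ↑ʳ j)
AB-edge {a} {b} i j = inj₁ (A-index b i , B-index a j)

BA-edge : ∀ {a b} (j : Fin b) (i : Fin a) → KAdj a b (a ↑ʳ j) (i ↑ˡ b)
BA-edge {a} {b} j i = inj₂ (B-index a j , A-index b i)

no-AA-edge : ∀ {a b} (i i′ : Fin a) → ¬ KAdj a b (i ↑ˡ b) (i′ ↑ˡ b)
no-AA-edge {b = b} i i′ (inj₁ (_ , a≤)) = <⇒≱ (A-index b i′) a≤
no-AA-edge {b = b} i i′ (inj₂ (a≤ , _)) = <⇒≱ (A-index b i) a≤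

no-BB-edge : ∀ {a b} (j j′ : Fin b) → ¬ KAdj a b (a ↑ʳ j) (a ↑ʳ j′)
no-BB-edge {a} j j′ (inj₁ (<a , _)) = <⇒≱ <a (B-index a j)
no-BB-edge {a} j j′ (inj₂ (_ , <a)) = <⇒≱ <a (B-index a j′)

onA : ∀ {a b k} → (Fin (a + b) → Subset k) → Fin a → Subset k
onA {b = b} f i = f (i ↑ˡ b)

onB : ∀ {a b k} → (Fin (a + b) → Subset k) → Fin b → Subset k
onB {a} f j = f (a ↑ʳ j)

weight-parts : ∀ {a b k} (f : Fin (a + b) → Subset k) →
  weight (K a b) k f ≡ total (onA {a} {b} f) + total (onB {a} {b} f)
weight-parts {a} {b} f = sum-tabulate-↑ a b (λ v → ∣ f v ∣)

A-empty⇒B-covers : ∀ {a b k} {f : Fin (a + b) → Subset k} → IsKRDF (K a b) k f →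
  (i : Fin a) → f (i ↑ˡ b) ≡ ⊥ → Covers (onB {a} {b} f)
A-empty⇒B-covers {a} {b} kr i f≡⊥ c with kr (i ↑ˡ b) f≡⊥ c
... | u , adj , c∈ with part a b u
...   | inA i′ = ⊥-elim (no-AA-edge i i′ adj)
...   | inB j  = j , c∈

B-empty⇒A-covers : ∀ {a b k} {f : Fin (a + b) → Subset k} → IsKRDF (K a b) k f →
  (j : Fin b) → f (a ↑ʳ j) ≡ ⊥ → Covers (onA {a} {b} f)
B-empty⇒A-covers {a} {b} kr j f≡⊥ c with kr (a ↑ʳ j) f≡⊥ c
... | u , adj , c∈ with part a b u
...   | inA i  = i , c∈
...   | inB j′ = ⊥-elim (no-BB-edge j j′ adj)

glue : ∀ {a b k} → (Fin a → Subset k) → (Fin b → Subset k) → Fin (a + b) → Subset k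
glue {a} g h v = [ g , h ]′ (splitAt a v)

glue-A : ∀ {a b k} (g : Fin a → Subset k) (h : Fin b → Subset k) i → glue g h (i ↑ˡ b) ≡ g i
glue-A {a} {b} g h i = cong [ g , h ]′ (splitAt-↑ˡ a i b)

glue-B : ∀ {a b k} (g : Fin a → Subset k) (h : Fin b → Subset k) j → glue g h (a ↑ʳ j) ≡ h j
glue-B {a} {b} g h j = cong [ g , h ]′ (splitAt-↑ʳ a b j)

glue-KRDF : ∀ {a b k} (g : Fin a → Subset k) (h : Fin b → Subset k) →
  (∀ i → g i ≡ ⊥ → Covers h) → (∀ j → h j ≡ ⊥ → Covers g) → IsKRDF (K a b) k (glue g h)
glue-KRDF {a} {b} g h A-ok B-ok v f≡⊥ c with part a b v
... | inA i with A-ok i (trans (≡-sym (glue-A g h i)) f≡⊥) c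
...   | j , c∈ = a ↑ʳ j , AB-edge i j , subst (c ∈_) (≡-sym (glue-B g h j)) c∈
glue-KRDF {a} {b} g h A-ok B-ok v f≡⊥ c | inB j with B-ok j (trans (≡-sym (glue-B g h j)) f≡⊥) c
...   | i , c∈ = i ↑ˡ b , BA-edge j i , subst (c ∈_) (≡-sym (glue-A g h i)) c∈

glue-weight : ∀ {a b k} (g : Fin a → Subset k) (h : Fin b → Subset k) →
  weight (K a b) k (glue g h) ≡ total g + total h
glue-weight {a} {b} g h = trans (weight-parts {a} {b} (glue g h))
  (cong₂ _+_ (cong sum (tabulate-cong (λ i → cong ∣_∣ (glue-A g h i))))
             (cong sum (tabulate-cong (λ j → cong ∣_∣ (glue-B g h j)))))

μ : ℕ → ℕ → ℕ → ℕ
μ a b k = ((a + b) ⊓ (a ⊔ k)) ⊓ (2 * k)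

part-alternatives : ∀ {a b k} {f : Fin (a + b) → Subset k} → IsKRDF (K a b) k f →
  (a ≤ total (onA {a} {b} f) ⊎ k ≤ total (onB {a} {b} f)) ×
  (b ≤ total (onB {a} {b} f) ⊎ k ≤ total (onA {a} {b} f))
part-alternatives {a} {b} {f = f} kr = A-side , B-side
  where
  A-side : a ≤ total (onA {a} {b} f) ⊎ _
  A-side with empty-or-m≤total (onA {a} {b} f)
  ... | inj₁ (i , f≡⊥) = inj₂ (covers⇒k≤total _ (A-empty⇒B-covers kr i f≡⊥))
  ... | inj₂ a≤        = inj₁ a≤
  B-side : b ≤ total (onB {a} {b} f) ⊎ _
  B-side with empty-or-m≤total (onB {a} {b} f)
  ... | inj₁ (j , f≡⊥) = inj₂ (covers⇒k≤total _ (B-empty⇒A-covers kr j f≡⊥))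
  ... | inj₂ b≤        = inj₁ b≤

μ≤x+y : ∀ {a b k x y} → a ≤ b → (a ≤ x ⊎ k ≤ y) → (b ≤ y ⊎ k ≤ x) → μ a b k ≤ x + y
μ≤x+y {a} {b} {k} {x} {y} a≤b = combine
  where
  μ≤a+b : μ a b k ≤ a + b
  μ≤a+b = ≤-trans (m⊓n≤m _ _) (m⊓n≤m _ _)
  μ≤a⊔k : μ a b k ≤ a ⊔ k
  μ≤a⊔k = ≤-trans (m⊓n≤m _ _) (m⊓n≤n _ _)
  μ≤2k : μ a b k ≤ 2 * k
  μ≤2k = m⊓n≤n _ _
  combine : (a ≤ x ⊎ k ≤ y) → (b ≤ y ⊎ k ≤ x) → μ a b k ≤ x + y
  combine (inj₁ a≤x) (inj₁ b≤y) = ≤-trans μ≤a+b (+-mono-≤ a≤x b≤y)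
  combine (inj₁ a≤x) (inj₂ k≤x) = ≤-trans μ≤a⊔k (≤-trans (⊔-lub a≤x k≤x) (m≤m+n x y))
  combine (inj₂ k≤y) (inj₁ b≤y) = ≤-trans μ≤a⊔k (≤-trans (⊔-lub (≤-trans a≤b b≤y) k≤y) (m≤n+m y x))
  combine (inj₂ k≤y) (inj₂ k≤x) =
    ≤-trans μ≤2k (+-mono-≤ k≤x (subst (_≤ y) (≡-sym (+-identityʳ k)) k≤y))

μ≤weight : ∀ {a b k} → a ≤ b → (f : Fin (a + b) → Subset k) → IsKRDF (K a b) k f →
  μ a b k ≤ weight (K a b) k f
μ≤weight {a} {b} a≤b f kr with part-alternatives kr
... | A-alt , B-alt =
  subst (μ a b _ ≤_) (≡-sym (weight-parts {a} {b} f)) (μ≤x+y a≤b A-alt B-alt)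

KRDFOfWeight : (G : Graph) (k w : ℕ) → Set
KRDFOfWeight G k w = Σ (Fin (order G) → Subset k) λ f → IsKRDF G k f × weight G k f ≡ w

attained : ∀ {a b k T} → a ≤ b → T ≤ μ a b k → KRDFOfWeight (K a b) k T →
  RainbowDominationNumber (K a b) k T
attained a≤b T≤μ witness = witness , λ f kr → ≤-trans T≤μ (μ≤weight a≤b f kr)

one-colour-everywhere : ∀ (G : Graph) {k} → 1 ≤ k → KRDFOfWeight G k (order G)
one-colour-everywhere G {suc k} _ =
  (λ _ → first) ,
  (λ v f≡⊥ → ⊥-elim (nonempty⇒≢⊥ (zero , here) f≡⊥)) ,
  (begin
    total (λ (_ : Fin (order G)) → first) ≡⟨ total-const (order G) first ⟩
    order G * ∣ first ∣                   ≡⟨ cong (order G *_) (∣⁅x⁆∣≡1 {suc k} zero) ⟩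
    order G * 1                           ≡⟨ *-identityʳ (order G) ⟩
    order G                               ∎)
  where
  open ≡-Reasoning
  first : Subset (suc k)
  first = ⁅ zero ⁆

spread : ∀ m k → Fin m → Subset k
spread m       zero    _       = ⊥
spread (suc m) (suc k) zero    = ⁅ zero ⁆
spread (suc m) (suc k) (suc i) = outside ∷ spread m k i

spread-total : ∀ m k → total (spread m k) ≡ m ⊓ k
spread-total m       zero    =
  trans (total-const m (⊥ {0})) (trans (*-zeroʳ m) (≡-sym (⊓-zeroʳ m)))
spread-total zero    (suc k) = refl
spread-total (suc m) (suc k) = cong₂ _+_ (∣⁅x⁆∣≡1 {suc k} zero) (spread-total m k)

spread-covers : ∀ {m k} → k ≤ m → Covers (spread m k)
spread-covers (s≤s k≤m) zero    = zero , here
spread-covers (s≤s k≤m) (suc c) with spread-covers k≤m c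
... | i , c∈ = suc i , there c∈

-- Nonempty sets on suc m vertices covering [suc k] with total
-- (suc m) ⊔ (suc k): colour c on vertex c; if colours remain, the last
-- vertex takes all of them, and if vertices remain, they all repeat the
-- last colour.
blanket : ∀ m k → Fin (suc m) → Subset (suc k)
blanket m       zero    _       = ⊤
blanket zero    (suc k) zero    = ⊤
blanket (suc m) (suc k) zero    = ⁅ zero ⁆
blanket (suc m) (suc k) (suc i) = outside ∷ blanket m k i

blanket-nonempty : ∀ m k i → Nonempty (blanket m k i)
blanket-nonempty m       zero    _       = zero , ∈⊤
blanket-nonempty zero    (suc k) zero    = zero , ∈⊤
blanket-nonempty (suc m) (suc k) zero    = zero , here
blanket-nonempty (suc m) (suc k) (suc i) with blanket-nonempty m k i
... | c , c∈ = suc c , there c∈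

blanket-covers : ∀ m k → Covers (blanket m k)
blanket-covers m       zero    c       = zero , ∈⊤
blanket-covers zero    (suc k) c       = zero , ∈⊤
blanket-covers (suc m) (suc k) zero    = zero , here
blanket-covers (suc m) (suc k) (suc c) with blanket-covers m k c
... | i , c∈ = suc i , there c∈

blanket-total : ∀ m k → total (blanket m k) ≡ suc m ⊔ suc k
blanket-total m       zero    =
  trans (total-const (suc m) (⊤ {1})) (trans (*-identityʳ (suc m)) (≡-sym (m≥n⇒m⊔n≡m (s≤s z≤n))))
blanket-total zero    (suc k) = trans (+-identityʳ _) (∣⊤∣≡n (suc (suc k)))
blanket-total (suc m) (suc k) = cong₂ _+_ (∣⁅x⁆∣≡1 {suc (suc k)} zero) (blanket-total m k)

spread-both-parts : ∀ {a b k} → k ≤ a → k ≤ b → KRDFOfWeight (K a b) k (2 * k)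
spread-both-parts {a} {b} {k} k≤a k≤b =
  glue (spread a k) (spread b k) ,
  glue-KRDF (spread a k) (spread b k) (λ _ _ → spread-covers k≤b) (λ _ _ → spread-covers k≤a) ,
  (begin
    weight (K a b) k (glue (spread a k) (spread b k)) ≡⟨ glue-weight (spread a k) (spread b k) ⟩
    total (spread a k) + total (spread b k)           ≡⟨ cong₂ _+_ (spread-total a k) (spread-total b k) ⟩
    a ⊓ k + b ⊓ k                                     ≡⟨ cong₂ _+_ (m≥n⇒m⊓n≡n k≤a) (m≥n⇒m⊓n≡n k≤b) ⟩
    k + k                                             ≡⟨ cong (k +_) (≡-sym (+-identityʳ k)) ⟩
    2 * k                                             ∎)
  where open ≡-Reasoning

blanket-one-part : ∀ {a b k} → 1 ≤ a → 1 ≤ k → KRDFOfWeight (K a b) k (a ⊔ k)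
blanket-one-part {suc m} {b} {suc k} _ _ =
  glue (blanket m k) nothing ,
  glue-KRDF (blanket m k) nothing
    (λ i e → ⊥-elim (nonempty⇒≢⊥ (blanket-nonempty m k i) e))
    (λ _ _ → blanket-covers m k) ,
  (begin
    weight (K (suc m) b) (suc k) (glue (blanket m k) nothing) ≡⟨ glue-weight (blanket m k) nothing ⟩
    total (blanket m k) + total nothing      ≡⟨ cong₂ _+_ (blanket-total m k) (total-const b (⊥ {suc k})) ⟩
    (suc m ⊔ suc k) + b * ∣ ⊥ {suc k} ∣      ≡⟨ cong (λ s → (suc m ⊔ suc k) + b * s) (∣⊥∣≡0 (suc k)) ⟩
    (suc m ⊔ suc k) + b * 0                  ≡⟨ cong ((suc m ⊔ suc k) +_) (*-zeroʳ b) ⟩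
    (suc m ⊔ suc k) + 0                      ≡⟨ +-identityʳ _ ⟩
    suc m ⊔ suc k                            ∎)
  where
  open ≡-Reasoning
  nothing : Fin b → Subset (suc k)
  nothing _ = ⊥

lemma2 : (a b k : ℕ) → 1 ≤ a → a ≤ b → 1 ≤ k →
    (a + b ≤ k → RainbowDominationNumber (K a b) k (a + b))
    × (k < a + b →
        (2 * k ≤ a → RainbowDominationNumber (K a b) k (2 * k))
        × (a < 2 * k → RainbowDominationNumber (K a b) k (a ⊔ k)))
lemma2 a b k 1≤a a≤b 1≤k = few-vertices , λ k<a+b → large-parts , small-part k<a+b
  where
  k≤2k : k ≤ 2 * k
  k≤2k = m≤m+n k (k + 0)
  few-vertices : a + b ≤ k → RainbowDominationNumber (K a b) k (a + b)
  few-vertices a+b≤k = attained a≤b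
    (⊓-glb (⊓-glb ≤-refl (≤-trans a+b≤k (m≤n⊔m a k))) (≤-trans a+b≤k k≤2k))
    (one-colour-everywhere (K a b) 1≤k)
  large-parts : 2 * k ≤ a → RainbowDominationNumber (K a b) k (2 * k)
  large-parts 2k≤a = attained a≤b
    (⊓-glb (⊓-glb (≤-trans 2k≤a (m≤m+n a b)) (≤-trans 2k≤a (m≤m⊔n a k))) ≤-refl)
    (spread-both-parts k≤a (≤-trans k≤a a≤b))
    where k≤a = ≤-trans k≤2k 2k≤a
  small-part : k < a + b → a < 2 * k → RainbowDominationNumber (K a b) k (a ⊔ k)
  small-part k<a+b a<2k = attained a≤b
    (⊓-glb (⊓-glb (⊔-lub (m≤m+n a b) (<⇒≤ k<a+b)) ≤-refl) (⊔-lub (<⇒≤ a<2k) k≤2k))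
    (blanket-one-part 1≤a 1≤k)
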